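{- As formal power series in $x,y$, $$\sum_{k,n\ge0}a_{k,n}x^ky^n=\frac{1}{(1-x^2)(1-y^2)-xy}.$$
   Context: For nonnegative integers $p,q$, $a_{p,q}$ is the number of ways to partition a set consisting of $p$ marked points on a line and $q$ marked points on a parallel line into pairs, joining the two points of each pair by a straight segment, such that no two segments have a common point (in particular, no endpoint lies on another segment). We have $a_{0,0}=1$, and $a_{p,q}=0$ when $p+q$ is odd. -}

module Defs where

open import Data.Bool using (Bool; true; false; _∧_; _∨_; not)
open import Data.Nat using (ℕ; zero; suc; _+_; _∸_; _<ᵇ_; _≡ᵇ_)
open import Data.Fin using (Fin; toℕ; splitAt)
open import Data.Sum using (_⊎_; inj₁; inj₂)
open import Data.List using (List; []; _∷_; map; concatMap; allFin; length; filterᵇ; foldr; upTo)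
open import Data.Bool.ListAction using (and)
open import Data.Vec using (Vec; lookup) renaming ([] to []ᵥ; _∷_ to _∷ᵥ_)
open import Data.Integer using (ℤ; +_; -_) renaming (_+_ to _+ℤ_; _*_ to _*ℤ_; _-_ to _-ℤ_)

-- The p + q marked points are the elements of Fin (p + q):
-- via splitAt p, index inj₁ i is the point at position i (0 ≤ i < p) on
-- the first line, inj₂ j the point at position j (0 ≤ j < q) on the
-- second (parallel) line.  Positions increase in the same direction on
-- both lines.

line : (p q : ℕ) → Fin (p + q) → Bool
line p q x with splitAt p x
... | inj₁ _ = false
... | inj₂ _ = true

coord : (p q : ℕ) → Fin (p + q) → ℕ
coord p q x with splitAt p x
... | inj₁ i = toℕ i
... | inj₂ j = toℕ j

_==_ : Bool → Bool → Bool
true == b = b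
false == b = not b

eqFin : ∀ {n} → Fin n → Fin n → Bool
eqFin x y = toℕ x ≡ᵇ toℕ y

-- A partition of the points into pairs is encoded by the partner map
-- m (as a vector: lookup m x = the point paired with x), i.e. a
-- fixed-point-free involution.

Partner : ℕ → Set
Partner n = Vec (Fin n) n

allᵇ : ∀ {A : Set} → (A → Bool) → List A → Bool
allᵇ f xs = and (map f xs)

isPairing : ∀ {n} → Partner n → Bool
isPairing {n} m =
  allᵇ (λ x → eqFin (lookup m (lookup m x)) x ∧ not (eqFin (lookup m x) x)) (allFin n)

strictlyBetween : (p q : ℕ) → Fin (p + q) → Fin (p + q) → Fin (p + q) → Bool
strictlyBetween p q c a b =
  (line p q c == line p q a) ∧ (line p q c == line p q b) ∧
  (((coord p q a <ᵇ coord p q c) ∧ (coord p q c <ᵇ coord p q b)) ∨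
   ((coord p q b <ᵇ coord p q c) ∧ (coord p q c <ᵇ coord p q a)))

-- No marked point lies on a segment joining two points of the same line
-- (this also excludes any common point of two segments on the same line,
-- and of such a segment with a transversal segment, which meets the line
-- only at its endpoint).
noPointOnSegments : (p q : ℕ) → Partner (p + q) → Bool
noPointOnSegments p q m =
  allᵇ (λ x → allᵇ (λ c → not (strictlyBetween p q c x (lookup m x))) (allFin (p + q)))
      (allFin (p + q))

-- two transversal segments x—m x and y—m y (x, y on the first line,
-- m x, m y on the second) cross iff their endpoints are in opposite order.
crossing : (p q : ℕ) → Partner (p + q) → Fin (p + q) → Fin (p + q) → Bool
crossing p q m x y =
  not (line p q x) ∧ line p q (lookup m x) ∧
  not (line p q y) ∧ line p q (lookup m y) ∧
  (coord p q x <ᵇ coord p q y) ∧ (coord p q (lookup m y) <ᵇ coord p q (lookup m x))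

noCrossings : (p q : ℕ) → Partner (p + q) → Bool
noCrossings p q m =
  allᵇ (λ x → allᵇ (λ y → not (crossing p q m x y)) (allFin (p + q))) (allFin (p + q))

isValid : (p q : ℕ) → Partner (p + q) → Bool
isValid p q m = isPairing m ∧ noPointOnSegments p q m ∧ noCrossings p q m

allVecs : (n k : ℕ) → List (Vec (Fin k) n)
allVecs zero k = []ᵥ ∷ []
allVecs (suc n) k = concatMap (λ v → map (λ a → a ∷ᵥ v) (allFin k)) (allVecs n k)

a : ℕ → ℕ → ℕ
a p q = length (filterᵇ (isValid p q) (allVecs (p + q) (p + q)))

-- Formal power series in two variables x, y with integer coefficients:
-- F k n is the coefficient of x^k y^n.

FPS2 : Set
FPS2 = ℕ → ℕ → ℤ

sumℤ : List ℤ → ℤ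
sumℤ = foldr _+ℤ_ (+ 0)

_⊕_ : FPS2 → FPS2 → FPS2
(F ⊕ G) k n = F k n +ℤ G k n

_⊖_ : FPS2 → FPS2 → FPS2
(F ⊖ G) k n = F k n -ℤ G k n

_⊛_ : FPS2 → FPS2 → FPS2
(F ⊛ G) k n =
  sumℤ (map (λ i → sumℤ (map (λ j → F i j *ℤ G (k ∸ i) (n ∸ j)) (upTo (suc n))))
            (upTo (suc k)))

oneS : FPS2
oneS zero zero = + 1
oneS _ _ = + 0

X : FPS2
X 1 zero = + 1
X _ _ = + 0

Y : FPS2
Y zero 1 = + 1
Y _ _ = + 0

denom : FPS2
denom = ((oneS ⊖ (X ⊛ X)) ⊛ (oneS ⊖ (Y ⊛ Y))) ⊖ (X ⊛ Y)

genA : FPS2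
genA k n = + (a k n)

module Submission where

-- We count the completions of a partial pairing of an initial
-- region (the first i and j points of the two lines) by the partner of the
-- first free point: its neighbour on its line, or the first free point of the
-- other line.  This gives a = α, for α and β defined by that recursion.
--
-- Multiplying by a monomial shifts coefficients and the denominator
-- is a sum of five monomials, so the theorem says
-- α k n - α (k-2) n - α k (n-2) + α (k-2) (n-2) - α (k-1) (n-1) = [k = n = 0],
-- which follows from the recursion.

open import Defs
open import Relation.Binary.PropositionalEquality
open import Relation.Nullary using (¬_; yes; no)
open import Data.Empty using (⊥; ⊥-elim)
open import Data.Unit using (tt)
open import Data.Product using (_×_; _,_; proj₁; proj₂)
open import Data.Sum.Function.Propositional using (_⊎-⇔_)
open import Data.Sum using (_⊎_; inj₁; inj₂)
open import Data.Nat
  using (ℕ; zero; suc; _+_; _∸_; _<ᵇ_; _≡ᵇ_; _≤ᵇ_; _≤_; _<_; s≤s; s≤s⁻¹; z<s; _<?_; _≤?_; _≟_)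
open import Data.Nat.Properties
open import Data.Bool using (Bool; true; false; _∧_; _∨_; not; if_then_else_; T)
open import Data.Bool.Properties
  using (∧-identityʳ; ∧-zeroʳ; ∧-assoc; ∧-comm; T-∧; T-∨; T-≡; T-not-≡; ⇔→≡)
open import Data.Fin using (Fin; toℕ; fromℕ<; splitAt) renaming (zero to fzero; suc to fsuc)
open import Data.Fin.Properties
  using (toℕ<n; toℕ-fromℕ<; splitAt⁻¹-↑ˡ; splitAt⁻¹-↑ʳ; toℕ-↑ˡ; toℕ-↑ʳ)
open import Data.List
  using (List; []; _∷_; map; concatMap; _++_; allFin; tabulate; length; filterᵇ; upTo)
open import Data.List.Properties using (map-tabulate; map-cong; map-++; upTo-∷ʳ)
open import Data.List.Membership.Propositional using (_∈_)
open import Data.List.Membership.Propositional.Properties using (∈-allFin)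
open import Data.List.Relation.Unary.Any using (here; there)
open import Data.Vec using (Vec; lookup) renaming ([] to []ᵥ; _∷_ to _∷ᵥ_)
open import Data.Integer using (ℤ; +_) renaming (_+_ to _+ℤ_; _-_ to _-ℤ_; _*_ to _*ℤ_)
import Data.Integer.Properties as ℤ
open import Data.Integer.Solver using (module +-*-Solver)
open +-*-Solver using (solve; _:+_; _:-_; _:*_; _:=_; con)
open import Function.Bundles using (_⇔_; mk⇔; Equivalence)
open Equivalence using (to; from)
open import Function.Construct.Composition using (_⇔-∘_)
open import Function.Construct.Symmetry using (⇔-sym)
open import Function.Related.TypeIsomorphisms using (¬-cong-⇔; →-cong-⇔)

module T-∧ {a b} = Equivalence (T-∧ {a} {b})

T-cong : ∀ {a b} → a ≡ b → T a ⇔ T b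
T-cong refl = mk⇔ (λ t → t) (λ t → t)

T-injective : ∀ {a b} → T a ⇔ T b → a ≡ b
T-injective e = ⇔→≡ {z = true} ((T-≡ ⇔-∘ e) ⇔-∘ ⇔-sym T-≡)

T-not : ∀ {b} → T (not b) ⇔ (¬ T b)
T-not {true} = mk⇔ (λ ()) (λ f → f tt)
T-not {false} = mk⇔ (λ _ ()) (λ _ → tt)

T-∧⇔ : ∀ {a b} {A B : Set} → T a ⇔ A → (A → T b ⇔ B) → T (a ∧ b) ⇔ (A × B)
T-∧⇔ {a} ea eb = mk⇔
  (λ t → let (ta , tb) = T-∧.to {a} t ; x = to ea ta in x , to (eb x) tb)
  (λ (x , y) → T-∧.from (from ea x , from (eb x) y))

≡ᵇ⇔ : ∀ {m n} → T (m ≡ᵇ n) ⇔ (m ≡ n)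
≡ᵇ⇔ = mk⇔ (≡ᵇ⇒≡ _ _) (≡⇒≡ᵇ _ _)

<ᵇ⇔ : ∀ {m n} → T (m <ᵇ n) ⇔ (m < n)
<ᵇ⇔ = mk⇔ (<ᵇ⇒< _ _) <⇒<ᵇ

≤ᵇ⇔ : ∀ {m n} → T (m ≤ᵇ n) ⇔ (m ≤ n)
≤ᵇ⇔ = mk⇔ (≤ᵇ⇒≤ _ _) ≤⇒≤ᵇ

∧-swapʳ : ∀ a b c → ((a ∧ b) ∧ c) ≡ ((a ∧ c) ∧ b)
∧-swapʳ a b c = trans (∧-assoc a b c) (trans (cong (a ∧_) (∧-comm b c)) (sym (∧-assoc a c b)))

decided : ∀ {b} {P : Set} → T b ⇔ P → P → b ≡ true
decided e x = to T-≡ (from e x)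

refuted : ∀ {b} {P : Set} → T b ⇔ P → ¬ P → b ≡ false
refuted e ¬x = to T-not-≡ (from T-not (λ t → ¬x (to e t)))

allFin⇔ : ∀ {n} {f : Fin n → Bool} {P : ℕ → Set} → (∀ i → T (f i) ⇔ P (toℕ i)) →
  T (allᵇ f (allFin n)) ⇔ (∀ x → x < n → P x)
allFin⇔ {n} {f} {P} pointwise = mk⇔ decode encode
  where
  elim : ∀ xs → T (allᵇ f xs) → ∀ {i} → i ∈ xs → T (f i)
  elim (y ∷ ys) t (here refl) = proj₁ (T-∧.to t)
  elim (y ∷ ys) t (there i∈) = elim ys (proj₂ (T-∧.to t)) i∈
  intro : ∀ xs → (∀ i → T (f i)) → T (allᵇ f xs)
  intro [] h = tt
  intro (y ∷ ys) h = T-∧.from (h y , intro ys h)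
  decode : T (allᵇ f (allFin n)) → ∀ x → x < n → P x
  decode t x x<n = subst P (toℕ-fromℕ< x<n) (to (pointwise _) (elim (allFin n) t (∈-allFin (fromℕ< x<n))))
  encode : (∀ x → x < n → P x) → T (allᵇ f (allFin n))
  encode h = intro (allFin n) (λ i → from (pointwise i) (h (toℕ i) (toℕ<n i)))

count : ∀ {A : Set} → (A → Bool) → List A → ℕ
count f xs = length (filterᵇ f xs)

count-cong : ∀ {A : Set} (f g : A → Bool) xs → (∀ x → f x ≡ g x) → count f xs ≡ count g xs
count-cong f g [] e = refl
count-cong f g (x ∷ xs) e with f x | g x | e x
... | true  | true  | refl = cong suc (count-cong f g xs e)
... | false | false | refl = count-cong f g xs e

count-split : ∀ {A : Set} (f g : A → Bool) xs →
  count f xs ≡ count (λ x → f x ∧ g x) xs + count (λ x → f x ∧ not (g x)) xs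
count-split f g [] = refl
count-split f g (x ∷ xs) with f x | g x
... | true  | true  = cong suc (count-split f g xs)
... | true  | false = trans (cong suc (count-split f g xs)) (sym (+-suc _ _))
... | false | _     = count-split f g xs

count-none : ∀ {A : Set} (f : A → Bool) xs → (∀ x → f x ≡ false) → count f xs ≡ 0
count-none f [] e = refl
count-none f (x ∷ xs) e with f x | e x
... | false | refl = count-none f xs e

count-never : ∀ {A : Set} (f : A → Bool) xs → (∀ x → ¬ T (f x)) → count f xs ≡ 0
count-never f xs never = count-none f xs (λ x → to T-not-≡ (from T-not (never x)))

count-++ : ∀ {A : Set} (f : A → Bool) xs ys → count f (xs ++ ys) ≡ count f xs + count f ys
count-++ f [] ys = refl
count-++ f (x ∷ xs) ys with f x
... | true  = cong suc (count-++ f xs ys)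
... | false = count-++ f xs ys

count-map : ∀ {A B : Set} (f : B → Bool) (h : A → B) xs → count f (map h xs) ≡ count (λ x → f (h x)) xs
count-map f h [] = refl
count-map f h (x ∷ xs) with f (h x)
... | true  = cong suc (count-map f h xs)
... | false = count-map f h xs

⟦_⟧ : Bool → ℕ
⟦ true ⟧ = 1
⟦ false ⟧ = 0

count-concatMap : ∀ {A B : Set} (f : B → Bool) (h : A → List B) (e : A → Bool) xs →
  (∀ x → count f (h x) ≡ ⟦ e x ⟧) → count f (concatMap h xs) ≡ count e xs
count-concatMap f h e [] p = refl
count-concatMap f h e (x ∷ xs) p
  rewrite count-++ f (h x) (concatMap h xs) | p x | count-concatMap f h e xs p with e x
... | true  = refl
... | false = refl

count-successors : ∀ {K} (f : Fin (suc K) → Bool) →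
  count f (tabulate fsuc) ≡ count (λ a → f (fsuc a)) (allFin K)
count-successors {K} f = trans (cong (count f) (sym (map-tabulate (λ i → i) fsuc))) (count-map f fsuc (allFin K))

count-allFin-suc : ∀ {K} (f : Fin (suc K) → Bool) →
  count f (allFin (suc K)) ≡ ⟦ f fzero ⟧ + count (λ a → f (fsuc a)) (allFin K)
count-allFin-suc {K} f with f fzero
... | true  = cong suc (count-successors f)
... | false = count-successors f

count-index : ∀ K c → c < K → count (λ (a : Fin K) → toℕ a ≡ᵇ c) (allFin K) ≡ 1
count-index (suc K) zero _ =
  trans (count-allFin-suc {K} (λ a → toℕ a ≡ᵇ 0)) (cong suc (count-none _ (allFin K) (λ _ → refl)))
count-index (suc K) (suc c) (s≤s c<K) =
  trans (count-allFin-suc {K} (λ a → toℕ a ≡ᵇ suc c)) (count-index K c c<K)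

entry : ∀ {K n} → Vec (Fin K) n → ℕ → ℕ
entry []ᵥ x = 0
entry (a ∷ᵥ v) zero = toℕ a
entry (a ∷ᵥ v) (suc x) = entry v x

entry-lookup : ∀ {K n} (v : Vec (Fin K) n) (i : Fin n) → entry v (toℕ i) ≡ toℕ (lookup v i)
entry-lookup (a ∷ᵥ v) fzero = refl
entry-lookup (a ∷ᵥ v) (fsuc i) = entry-lookup v i

entry-< : ∀ {K n} (v : Vec (Fin K) n) x → x < n → entry v x < K
entry-< (a ∷ᵥ v) zero _ = toℕ<n a
entry-< (a ∷ᵥ v) (suc x) (s≤s x<n) = entry-< v x x<n

agreesᵇ : ∀ {K n} → (ℕ → ℕ) → Vec (Fin K) n → Bool
agreesᵇ g []ᵥ = true
agreesᵇ g (a ∷ᵥ v) = (toℕ a ≡ᵇ g 0) ∧ agreesᵇ (λ x → g (suc x)) v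

agreesᵇ⇔ : ∀ {K n} (g : ℕ → ℕ) (v : Vec (Fin K) n) → T (agreesᵇ g v) ⇔ (∀ x → x < n → entry v x ≡ g x)
agreesᵇ⇔ g []ᵥ = mk⇔ (λ _ x ()) (λ _ → tt)
agreesᵇ⇔ g (a ∷ᵥ v) = mk⇔ join split ⇔-∘ T-∧⇔ ≡ᵇ⇔ (λ _ → agreesᵇ⇔ (λ x → g (suc x)) v)
  where
  split : (∀ x → x < suc _ → entry (a ∷ᵥ v) x ≡ g x) → (toℕ a ≡ g 0) × (∀ x → x < _ → entry v x ≡ g (suc x))
  split h = h 0 z<s , λ x x<n → h (suc x) (s≤s x<n)
  join : (toℕ a ≡ g 0) × (∀ x → x < _ → entry v x ≡ g (suc x)) → ∀ x → x < suc _ → entry (a ∷ᵥ v) x ≡ g x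
  join (e , h) zero _ = e
  join (e , h) (suc x) (s≤s x<n) = h x x<n

unique-vector : ∀ n K (g : ℕ → ℕ) → (∀ x → x < n → g x < K) → count (agreesᵇ g) (allVecs n K) ≡ 1
unique-vector zero K g h = refl
unique-vector (suc n) K g h =
  trans (count-concatMap (agreesᵇ g) (λ v → map (_∷ᵥ v) (allFin K)) (agreesᵇ g′) (allVecs n K) heads)
        (unique-vector n K g′ (λ x x<n → h (suc x) (s≤s x<n)))
  where
  g′ : ℕ → ℕ
  g′ x = g (suc x)
  heads : ∀ v → count (agreesᵇ g) (map (_∷ᵥ v) (allFin K)) ≡ ⟦ agreesᵇ g′ v ⟧
  heads v rewrite count-map (agreesᵇ g) (_∷ᵥ v) (allFin K) with agreesᵇ g′ v
  ... | true  = trans (count-cong _ (λ a → toℕ a ≡ᵇ g 0) (allFin K) (λ a → ∧-identityʳ _))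
                      (count-index K (g 0) (h 0 z<s))
  ... | false = count-none _ (allFin K) (λ a → ∧-zeroʳ _)

index₁ : ∀ {p q} {x : Fin (p + q)} {i} → splitAt p x ≡ inj₁ i → toℕ x ≡ toℕ i
index₁ {p} {q} {i = i} eq = trans (cong toℕ (sym (splitAt⁻¹-↑ˡ eq))) (toℕ-↑ˡ i q)

index₂ : ∀ {p q} {x : Fin (p + q)} {j} → splitAt p x ≡ inj₂ j → toℕ x ≡ p + toℕ j
index₂ {p} {q} {j = j} eq = trans (cong toℕ (sym (splitAt⁻¹-↑ʳ eq))) (toℕ-↑ʳ p j)

-- Positions 0 … p-1 are the points of the first line, p … p+q-1 those of the
-- second.  The tests of isValid are rewritten as statements about positions.
module Positions (p q : ℕ) where

  N : ℕ
  N = p + q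

  lineN : ℕ → Bool
  lineN x = not (x <ᵇ p)

  coordN : ℕ → ℕ
  coordN x = if x <ᵇ p then x else x ∸ p

  line-toℕ : ∀ x → line p q x ≡ lineN (toℕ x)
  line-toℕ x with splitAt p x in eq
  ... | inj₁ i rewrite decided <ᵇ⇔ (subst (_< p) (sym (index₁ eq)) (toℕ<n i)) = refl
  ... | inj₂ j rewrite refuted <ᵇ⇔ (≤⇒≯ (subst (p ≤_) (sym (index₂ eq)) (m≤m+n p (toℕ j)))) = refl

  coord-toℕ : ∀ x → coord p q x ≡ coordN (toℕ x)
  coord-toℕ x with splitAt p x in eq
  ... | inj₁ i rewrite decided <ᵇ⇔ (subst (_< p) (sym (index₁ eq)) (toℕ<n i)) = sym (index₁ eq)
  ... | inj₂ j rewrite refuted <ᵇ⇔ (≤⇒≯ (subst (p ≤_) (sym (index₂ eq)) (m≤m+n p (toℕ j)))) =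
        trans (sym (m+n∸m≡n p (toℕ j))) (cong (_∸ p) (sym (index₂ eq)))

  on-first⇔ : ∀ x → T (not (lineN x)) ⇔ (x < p)
  on-first⇔ x with x <? p
  ... | yes x<p rewrite decided <ᵇ⇔ x<p = mk⇔ (λ _ → x<p) (λ _ → tt)
  ... | no x≮p rewrite refuted <ᵇ⇔ x≮p = mk⇔ (λ ()) x≮p

  on-second⇔ : ∀ x → T (lineN x) ⇔ (p ≤ x)
  on-second⇔ x with x <? p
  ... | yes x<p rewrite decided <ᵇ⇔ x<p = mk⇔ (λ ()) (<⇒≱ x<p)
  ... | no x≮p rewrite refuted <ᵇ⇔ x≮p = mk⇔ (λ _ → ≮⇒≥ x≮p) (λ _ → tt)

  SameLine : ℕ → ℕ → Set
  SameLine x y = (x < p × y < p) ⊎ (p ≤ x × p ≤ y)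

  sameLine-sym : ∀ {x y} → SameLine x y → SameLine y x
  sameLine-sym (inj₁ (x<p , y<p)) = inj₁ (y<p , x<p)
  sameLine-sym (inj₂ (p≤x , p≤y)) = inj₂ (p≤y , p≤x)

  sameLine-trans : ∀ {x y z} → SameLine x y → SameLine y z → SameLine x z
  sameLine-trans (inj₁ (x<p , _)) (inj₁ (_ , z<p)) = inj₁ (x<p , z<p)
  sameLine-trans (inj₂ (p≤x , _)) (inj₂ (_ , p≤z)) = inj₂ (p≤x , p≤z)
  sameLine-trans (inj₁ (_ , y<p)) (inj₂ (p≤y , _)) = ⊥-elim (<⇒≱ y<p p≤y)
  sameLine-trans (inj₂ (_ , p≤y)) (inj₁ (y<p , _)) = ⊥-elim (<⇒≱ y<p p≤y)

  sameLine⇔ : ∀ x y → T (lineN x == lineN y) ⇔ SameLine x y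
  sameLine⇔ x y with x <? p | y <? p
  ... | yes x<p | yes y<p rewrite decided <ᵇ⇔ x<p | decided <ᵇ⇔ y<p =
        mk⇔ (λ _ → inj₁ (x<p , y<p)) (λ _ → tt)
  ... | no x≮p | no y≮p rewrite refuted <ᵇ⇔ x≮p | refuted <ᵇ⇔ y≮p =
        mk⇔ (λ _ → inj₂ (≮⇒≥ x≮p , ≮⇒≥ y≮p)) (λ _ → tt)
  ... | yes x<p | no y≮p rewrite decided <ᵇ⇔ x<p | refuted <ᵇ⇔ y≮p =
        mk⇔ (λ ()) λ { (inj₁ (_ , y<p)) → y≮p y<p ; (inj₂ (p≤x , _)) → <⇒≱ x<p p≤x }
  ... | no x≮p | yes y<p rewrite refuted <ᵇ⇔ x≮p | decided <ᵇ⇔ y<p =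
        mk⇔ (λ ()) λ { (inj₁ (x<p , _)) → x≮p x<p ; (inj₂ (_ , p≤y)) → <⇒≱ y<p p≤y }

  coord-<⇔ : ∀ {x y} → SameLine x y → T (coordN x <ᵇ coordN y) ⇔ (x < y)
  coord-<⇔ (inj₁ (x<p , y<p)) rewrite decided <ᵇ⇔ x<p | decided <ᵇ⇔ y<p = <ᵇ⇔
  coord-<⇔ {x} {y} (inj₂ (p≤x , p≤y)) rewrite refuted <ᵇ⇔ (≤⇒≯ p≤x) | refuted <ᵇ⇔ (≤⇒≯ p≤y) =
    mk⇔ (λ t → reflect (<ᵇ⇒< _ _ t)) (λ x<y → <⇒<ᵇ (∸-monoˡ-< x<y p≤x))
    where
    reflect : x ∸ p < y ∸ p → x < y
    reflect lt = ≰⇒> (λ y≤x → <⇒≱ lt (∸-monoˡ-≤ p y≤x))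

  Between : ℕ → ℕ → ℕ → Set
  Between c a b = (a < c × c < b) ⊎ (b < c × c < a)

  Inside : ℕ → ℕ → ℕ → Set
  Inside c a b = SameLine c a × SameLine c b × Between c a b

  inside : ∀ {x c y} → x < c → c < y → SameLine x y → Inside c x y
  inside x<c c<y (inj₁ (x<p , y<p)) = inj₁ (<-trans c<y y<p , x<p) , inj₁ (<-trans c<y y<p , y<p) , inj₁ (x<c , c<y)
  inside x<c c<y (inj₂ (p≤x , p≤y)) =
    inj₂ (≤-trans p≤x (<⇒≤ x<c) , p≤x) , inj₂ (≤-trans p≤x (<⇒≤ x<c) , p≤y) , inj₁ (x<c , c<y)

  insideN : ℕ → ℕ → ℕ → Bool
  insideN c a b = (lineN c == lineN a) ∧ (lineN c == lineN b) ∧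
    (((coordN a <ᵇ coordN c) ∧ (coordN c <ᵇ coordN b)) ∨ ((coordN b <ᵇ coordN c) ∧ (coordN c <ᵇ coordN a)))

  strictlyBetween-toℕ : ∀ c a b → strictlyBetween p q c a b ≡ insideN (toℕ c) (toℕ a) (toℕ b)
  strictlyBetween-toℕ c a b
    rewrite line-toℕ c | line-toℕ a | line-toℕ b | coord-toℕ c | coord-toℕ a | coord-toℕ b = refl

  insideN⇔ : ∀ c a b → T (insideN c a b) ⇔ Inside c a b
  insideN⇔ c a b = T-∧⇔ (sameLine⇔ c a) λ ca → T-∧⇔ (sameLine⇔ c b) λ cb →
    (T-∧⇔ (coord-<⇔ (sameLine-sym ca)) (λ _ → coord-<⇔ cb) ⊎-⇔
     T-∧⇔ (coord-<⇔ (sameLine-sym cb)) (λ _ → coord-<⇔ ca)) ⇔-∘ T-∨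

  Crossing : ℕ → ℕ → ℕ → ℕ → Set
  Crossing x y fx fy = x < p × p ≤ fx × y < p × p ≤ fy × x < y × fy < fx

  crossing-<N : ∀ {x y fx fy} → Crossing x y fx fy → x < N × y < N
  crossing-<N (x<p , _ , y<p , _) = <-≤-trans x<p (m≤m+n p q) , <-≤-trans y<p (m≤m+n p q)

  crossingN : ℕ → ℕ → ℕ → ℕ → Bool
  crossingN x y fx fy = not (lineN x) ∧ lineN fx ∧ not (lineN y) ∧ lineN fy ∧
    (coordN x <ᵇ coordN y) ∧ (coordN fy <ᵇ coordN fx)

  crossing-toℕ : ∀ (m : Vec (Fin N) N) x y →
    crossing p q m x y ≡ crossingN (toℕ x) (toℕ y) (toℕ (lookup m x)) (toℕ (lookup m y))
  crossing-toℕ m x y rewrite line-toℕ x | line-toℕ y | line-toℕ (lookup m x) | line-toℕ (lookup m y)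
    | coord-toℕ x | coord-toℕ y | coord-toℕ (lookup m x) | coord-toℕ (lookup m y) = refl

  crossingN⇔ : ∀ x y fx fy → T (crossingN x y fx fy) ⇔ Crossing x y fx fy
  crossingN⇔ x y fx fy =
    T-∧⇔ (on-first⇔ x) λ x<p → T-∧⇔ (on-second⇔ fx) λ p≤fx → T-∧⇔ (on-first⇔ y) λ y<p →
    T-∧⇔ (on-second⇔ fy) λ p≤fy → T-∧⇔ (coord-<⇔ (inj₁ (x<p , y<p))) λ _ → coord-<⇔ (inj₂ (p≤fy , p≤fx))

  record Admissible (f : ℕ → ℕ) : Set where
    field
      bounded        : ∀ x → x < N → f x < N
      involutive     : ∀ x → x < N → f (f x) ≡ x
      fixpoint-free  : ∀ x → x < N → f x ≢ x
      empty-segments : ∀ x c → x < N → x < c → c < f x → SameLine x (f x) → ⊥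
      non-crossing   : ∀ x y → ¬ Crossing x y (f x) (f y)

  module Tests (m : Vec (Fin N) N) where
    f : ℕ → ℕ
    f = entry m

    Pairing NoPointInside NoCrossing : Set
    Pairing = ∀ x → x < N → f (f x) ≡ x × f x ≢ x
    NoPointInside = ∀ x → x < N → ∀ c → c < N → ¬ Inside c x (f x)
    NoCrossing = ∀ x → x < N → ∀ y → y < N → ¬ Crossing x y (f x) (f y)

    pairing⇔ : T (isPairing m) ⇔ Pairing
    pairing⇔ = allFin⇔ λ X → T-∧⇔ (value⇔ (f∘f-lookup X)) (λ _ → ¬-cong-⇔ (value⇔ (entry-lookup m X)) ⇔-∘ T-not)
      where
      value⇔ : ∀ {u v w} → w ≡ u → T (u ≡ᵇ v) ⇔ (w ≡ v)
      value⇔ refl = ≡ᵇ⇔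
      f∘f-lookup : ∀ X → f (f (toℕ X)) ≡ toℕ (lookup m (lookup m X))
      f∘f-lookup X = trans (cong f (entry-lookup m X)) (entry-lookup m (lookup m X))

    noPointInside⇔ : T (noPointOnSegments p q m) ⇔ NoPointInside
    noPointInside⇔ = allFin⇔ λ X → allFin⇔ λ C →
      ¬-cong-⇔ (insideN⇔ (toℕ C) (toℕ X) (f (toℕ X))
                ⇔-∘ T-cong (trans (strictlyBetween-toℕ C X (lookup m X))
                                  (cong (insideN (toℕ C) (toℕ X)) (sym (entry-lookup m X)))))
      ⇔-∘ T-not

    noCrossing⇔ : T (noCrossings p q m) ⇔ NoCrossing
    noCrossing⇔ = allFin⇔ λ X → allFin⇔ λ Y →
      ¬-cong-⇔ (crossingN⇔ (toℕ X) (toℕ Y) (f (toℕ X)) (f (toℕ Y))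
                ⇔-∘ T-cong (trans (crossing-toℕ m X Y)
                                  (sym (cong₂ (crossingN (toℕ X) (toℕ Y)) (entry-lookup m X) (entry-lookup m Y)))))
      ⇔-∘ T-not

    admissible : (Pairing × NoPointInside × NoCrossing) ⇔ Admissible f
    admissible = mk⇔ decode encode
      where
      decode : Pairing × NoPointInside × NoCrossing → Admissible f
      decode (pairs , empty , uncrossed) = record
        { bounded        = entry-< m
        ; involutive     = λ x x<N → proj₁ (pairs x x<N)
        ; fixpoint-free  = λ x x<N → proj₂ (pairs x x<N)
        ; empty-segments = λ x c x<N x<c c<fx sl →
            empty x x<N c (<-trans c<fx (entry-< m x x<N)) (inside x<c c<fx sl)
        ; non-crossing   = λ x y cr → uncrossed x (proj₁ (crossing-<N cr)) y (proj₂ (crossing-<N cr)) cr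
        }
      encode : Admissible f → Pairing × NoPointInside × NoCrossing
      encode A = (λ x x<N → involutive x x<N , fixpoint-free x x<N) , empty , λ x _ y _ → non-crossing x y
        where
        open Admissible A
        -- a point inside a chord along a line; by symmetry the chord may be traversed from its left end
        empty : NoPointInside
        empty x x<N c _ (cx , cfx , inj₁ (x<c , c<fx)) =
          empty-segments x c x<N x<c c<fx (sameLine-trans (sameLine-sym cx) cfx)
        empty x x<N c _ (cx , cfx , inj₂ (fx<c , c<x)) =
          empty-segments (f x) c (bounded x x<N) fx<c (subst (c <_) (sym (involutive x x<N)) c<x)
            (subst (SameLine (f x)) (sym (involutive x x<N)) (sameLine-trans (sameLine-sym cfx) cx))

  admissible⇔ : ∀ m → T (isValid p q m) ⇔ Admissible (entry m)
  admissible⇔ m = admissible ⇔-∘ T-∧⇔ pairing⇔ (λ _ → T-∧⇔ noPointInside⇔ (λ _ → noCrossing⇔))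
    where open Tests m

-- Partial pairings of an initial region, and their completions

pairUp : (ℕ → ℕ) → ℕ → ℕ → ℕ → ℕ
pairUp ν a b x with x ≟ a
... | yes _ = b
... | no _ with x ≟ b
...   | yes _ = a
...   | no _ = ν x

pairUp-a : ∀ ν a b → pairUp ν a b a ≡ b
pairUp-a ν a b with a ≟ a
... | yes _ = refl
... | no a≢a = ⊥-elim (a≢a refl)

pairUp-b : ∀ ν a b → a ≢ b → pairUp ν a b b ≡ a
pairUp-b ν a b a≢b with b ≟ a
... | yes b≡a = ⊥-elim (a≢b (sym b≡a))
... | no _ with b ≟ b
...   | yes _ = refl
...   | no b≢b = ⊥-elim (b≢b refl)

pairUp-other : ∀ ν a b x → x ≢ a → x ≢ b → pairUp ν a b x ≡ ν x
pairUp-other ν a b x x≢a x≢b with x ≟ a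
... | yes x≡a = ⊥-elim (x≢a x≡a)
... | no _ with x ≟ b
...   | yes x≡b = ⊥-elim (x≢b x≡b)
...   | no _ = refl

module PartialPairings (p q : ℕ) where
  open Positions p q

  Region : ℕ → ℕ → ℕ → Set
  Region i j x = x < i ⊎ (p ≤ x × x < p + j)

  everywhere : ∀ {x} → x < N → Region p q x
  everywhere {x} x<N with x <? p
  ... | yes x<p = inj₁ x<p
  ... | no x≮p = inj₂ (≮⇒≥ x≮p , x<N)

  Adjacent : ℕ → ℕ → Set
  Adjacent a b = b ≡ suc a ⊎ a ≡ suc b

  record PartialPairing (D : ℕ → Set) (ν : ℕ → ℕ) : Set where
    field
      closed     : ∀ x → D x → D (ν x)
      involutive : ∀ x → D x → ν (ν x) ≡ x
      adjacent   : ∀ x → D x → SameLine x (ν x) → Adjacent x (ν x)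
      ordered    : ∀ x y → D x → D y → x < p → p ≤ ν x → y < p → p ≤ ν y → x < y → ν x < ν y

  record Move (i j i′ j′ a b : ℕ) : Set where
    field
      a<b     : a < b
      a<N     : a < N
      fresh-a : ¬ Region i j a
      fresh-b : ¬ Region i j b
      added-a : Region i′ j′ a
      added-b : Region i′ j′ b
      grows   : ∀ x → Region i′ j′ x → Region i j x ⊎ (x ≡ a ⊎ x ≡ b)
      keeps   : ∀ x → Region i j x → Region i′ j′ x
      short   : SameLine a b → Adjacent a b

  fresh₁ : ∀ {i j x} → ¬ Region i j x → x < p → i ≤ x
  fresh₁ ¬R x<p = ≮⇒≥ (λ x<i → ¬R (inj₁ x<i))

  fresh₂ : ∀ {i j x} → ¬ Region i j x → p ≤ x → p + j ≤ x
  fresh₂ ¬R p≤x = ≮⇒≥ (λ x<p+j → ¬R (inj₂ (p≤x , x<p+j)))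

  region₁ : ∀ {i j x} → Region i j x → x < p → x < i
  region₁ (inj₁ x<i) _ = x<i
  region₁ (inj₂ (p≤x , _)) x<p = ⊥-elim (<⇒≱ x<p p≤x)

  region₂ : ∀ {i j x} → Region i j x → p ≤ x → i ≤ p → x < p + j
  region₂ (inj₁ x<i) p≤x i≤p = ⊥-elim (<⇒≱ (<-≤-trans x<i i≤p) p≤x)
  region₂ (inj₂ (_ , x<p+j)) _ _ = x<p+j

  outside₁ : ∀ {i j x} → i ≤ x → x < p → ¬ Region i j x
  outside₁ i≤x x<p R = <⇒≱ (region₁ R x<p) i≤x

  outside₂ : ∀ {i j x} → i ≤ p → p + j ≤ x → ¬ Region i j x
  outside₂ i≤p p+j≤x R = <⇒≱ (region₂ R (≤-trans (m≤m+n _ _) p+j≤x) i≤p) p+j≤x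

  adjacent-sym : ∀ {a b} → Adjacent a b → Adjacent b a
  adjacent-sym (inj₁ e) = inj₂ e
  adjacent-sym (inj₂ e) = inj₁ e

  unchanged : ∀ {i j i′ j′ a b} → Move i j i′ j′ a b → ∀ ν {x} → Region i j x → pairUp ν a b x ≡ ν x
  unchanged {a = a} {b} M ν {x} Rx =
    pairUp-other ν a b x (λ { refl → Move.fresh-a M Rx }) (λ { refl → Move.fresh-b M Rx })

  -- Adding a pair of fresh points to a partial pairing keeps it a partial
  -- pairing: a new transversal chord starts and ends after all old ones.
  extend : ∀ {i j i′ j′ a b ν} → i ≤ p → PartialPairing (Region i j) ν → Move i j i′ j′ a b →
    PartialPairing (Region i′ j′) (pairUp ν a b)
  extend {i} {j} {i′} {j′} {a} {b} {ν} i≤p P M = record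
    { closed = closed′ ; involutive = involutive′ ; adjacent = adjacent′ ; ordered = ordered′ }
    where
    open PartialPairing P
    open Move M
    ν′ = pairUp ν a b
    old : ∀ {x} → Region i j x → ν′ x ≡ ν x
    old = unchanged M ν
    ν′a : ν′ a ≡ b
    ν′a = pairUp-a ν a b
    ν′b : ν′ b ≡ a
    ν′b = pairUp-b ν a b (<⇒≢ a<b)
    closed′ : ∀ x → Region i′ j′ x → Region i′ j′ (ν′ x)
    closed′ x R′x with grows x R′x
    ... | inj₁ Rx = subst (Region i′ j′) (sym (old Rx)) (keeps _ (closed x Rx))
    ... | inj₂ (inj₁ refl) = subst (Region i′ j′) (sym ν′a) added-b
    ... | inj₂ (inj₂ refl) = subst (Region i′ j′) (sym ν′b) added-a
    involutive′ : ∀ x → Region i′ j′ x → ν′ (ν′ x) ≡ x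
    involutive′ x R′x with grows x R′x
    ... | inj₁ Rx = trans (cong ν′ (old Rx)) (trans (old (closed x Rx)) (involutive x Rx))
    ... | inj₂ (inj₁ refl) = trans (cong ν′ ν′a) ν′b
    ... | inj₂ (inj₂ refl) = trans (cong ν′ ν′b) ν′a
    adjacent′ : ∀ x → Region i′ j′ x → SameLine x (ν′ x) → Adjacent x (ν′ x)
    adjacent′ x R′x s with grows x R′x
    ... | inj₁ Rx rewrite old Rx = adjacent x Rx s
    ... | inj₂ (inj₁ refl) rewrite ν′a = short s
    ... | inj₂ (inj₂ refl) rewrite ν′b = adjacent-sym (short (sameLine-sym s))
    ordered′ : ∀ x y → Region i′ j′ x → Region i′ j′ y →
               x < p → p ≤ ν′ x → y < p → p ≤ ν′ y → x < y → ν′ x < ν′ y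
    ordered′ x y R′x R′y x<p px y<p py x<y with grows x R′x | grows y R′y
    ... | _ | inj₂ (inj₂ refl) rewrite ν′b = ⊥-elim (<⇒≱ (<-trans a<b y<p) py)
    ... | inj₂ (inj₂ refl) | _ rewrite ν′b = ⊥-elim (<⇒≱ (<-trans a<b x<p) px)
    ... | inj₂ (inj₁ refl) | inj₂ (inj₁ refl) = ⊥-elim (<-irrefl refl x<y)
    ... | inj₁ Rx | inj₁ Ry rewrite old Rx | old Ry = ordered x y Rx Ry x<p px y<p py x<y
    ... | inj₁ Rx | inj₂ (inj₁ refl) rewrite old Rx | ν′a =
          <-≤-trans (region₂ (closed x Rx) px i≤p) (fresh₂ fresh-b py)
    ... | inj₂ (inj₁ refl) | inj₁ Ry =
          ⊥-elim (<⇒≱ (region₁ Ry y<p) (≤-trans (fresh₁ fresh-a x<p) (<⇒≤ x<y)))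

  <2+ : ∀ {x n} → x < suc (suc n) → x < n ⊎ (x ≡ n ⊎ x ≡ suc n)
  <2+ lt with m<1+n⇒m<n∨m≡n lt
  ... | inj₂ e = inj₂ (inj₂ e)
  ... | inj₁ lt′ with m<1+n⇒m<n∨m≡n lt′
  ...   | inj₁ lt″ = inj₁ lt″
  ...   | inj₂ e = inj₂ (inj₁ e)

  p+2+j : ∀ j → p + suc (suc j) ≡ suc (suc (p + j))
  p+2+j j = trans (+-suc p (suc j)) (cong suc (+-suc p j))

  along₁ : ∀ {i j} → suc (suc i) ≤ p → Move i j (suc (suc i)) j i (suc i)
  along₁ {i} {j} 2+i≤p = record
    { a<b = n<1+n i ; a<N = <-≤-trans i<p (m≤m+n p q)
    ; fresh-a = outside₁ ≤-refl i<p ; fresh-b = outside₁ (n≤1+n i) 2+i≤p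
    ; added-a = inj₁ (m<n⇒m<1+n (n<1+n i)) ; added-b = inj₁ (n<1+n (suc i))
    ; grows = grows ; keeps = keeps ; short = λ _ → inj₁ refl }
    where
    i<p = <-trans (n<1+n i) 2+i≤p
    grows : ∀ x → Region (suc (suc i)) j x → Region i j x ⊎ (x ≡ i ⊎ x ≡ suc i)
    grows x (inj₁ x<2+i) with <2+ x<2+i
    ... | inj₁ x<i = inj₁ (inj₁ x<i)
    ... | inj₂ e = inj₂ e
    grows x (inj₂ R) = inj₁ (inj₂ R)
    keeps : ∀ x → Region i j x → Region (suc (suc i)) j x
    keeps x (inj₁ x<i) = inj₁ (m<n⇒m<1+n (m<n⇒m<1+n x<i))
    keeps x (inj₂ R) = inj₂ R

  along₂ : ∀ {i j} → i ≤ p → suc (suc j) ≤ q → Move i j i (suc (suc j)) (p + j) (suc (p + j))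
  along₂ {i} {j} i≤p 2+j≤q = record
    { a<b = n<1+n (p + j) ; a<N = +-monoʳ-< p (<-trans (n<1+n j) 2+j≤q)
    ; fresh-a = outside₂ i≤p ≤-refl ; fresh-b = outside₂ i≤p (n≤1+n _)
    ; added-a = inj₂ (m≤m+n p j , subst (p + j <_) (sym (p+2+j j)) (m<n⇒m<1+n (n<1+n _)))
    ; added-b = inj₂ (≤-trans (m≤m+n p j) (n≤1+n _) , subst (suc (p + j) <_) (sym (p+2+j j)) (n<1+n _))
    ; grows = grows ; keeps = keeps ; short = λ _ → inj₁ refl }
    where
    grows : ∀ x → Region i (suc (suc j)) x → Region i j x ⊎ (x ≡ p + j ⊎ x ≡ suc (p + j))
    grows x (inj₁ x<i) = inj₁ (inj₁ x<i)
    grows x (inj₂ (p≤x , x<p+2+j)) with <2+ (subst (x <_) (p+2+j j) x<p+2+j)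
    ... | inj₁ x<p+j = inj₁ (inj₂ (p≤x , x<p+j))
    ... | inj₂ e = inj₂ e
    keeps : ∀ x → Region i j x → Region i (suc (suc j)) x
    keeps x (inj₁ x<i) = inj₁ x<i
    keeps x (inj₂ (p≤x , x<p+j)) = inj₂ (p≤x , <-≤-trans x<p+j (+-monoʳ-≤ p (≤-trans (n≤1+n j) (n≤1+n _))))

  across : ∀ {i j} → i < p → Move i j (suc i) (suc j) i (p + j)
  across {i} {j} i<p = record
    { a<b = <-≤-trans i<p (m≤m+n p j) ; a<N = <-≤-trans i<p (m≤m+n p q)
    ; fresh-a = outside₁ ≤-refl i<p ; fresh-b = outside₂ (<⇒≤ i<p) ≤-refl
    ; added-a = inj₁ (n<1+n i) ; added-b = inj₂ (m≤m+n p j , subst (p + j <_) (sym (+-suc p j)) (n<1+n _))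
    ; grows = grows ; keeps = keeps ; short = short }
    where
    grows : ∀ x → Region (suc i) (suc j) x → Region i j x ⊎ (x ≡ i ⊎ x ≡ p + j)
    grows x (inj₁ x<1+i) with m<1+n⇒m<n∨m≡n x<1+i
    ... | inj₁ x<i = inj₁ (inj₁ x<i)
    ... | inj₂ e = inj₂ (inj₁ e)
    grows x (inj₂ (p≤x , x<p+1+j)) with m<1+n⇒m<n∨m≡n (subst (x <_) (+-suc p j) x<p+1+j)
    ... | inj₁ x<p+j = inj₁ (inj₂ (p≤x , x<p+j))
    ... | inj₂ e = inj₂ (inj₂ e)
    keeps : ∀ x → Region i j x → Region (suc i) (suc j) x
    keeps x (inj₁ x<i) = inj₁ (m<n⇒m<1+n x<i)
    keeps x (inj₂ (p≤x , x<p+j)) = inj₂ (p≤x , <-≤-trans x<p+j (+-monoʳ-≤ p (n≤1+n j)))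
    short : SameLine i (p + j) → Adjacent i (p + j)
    short (inj₁ (_ , p+j<p)) = ⊥-elim (<⇒≱ p+j<p (m≤m+n p j))
    short (inj₂ (p≤i , _)) = ⊥-elim (<⇒≱ i<p p≤i)

  inRegionᵇ : ℕ → ℕ → ℕ → Bool
  inRegionᵇ i j x = (x <ᵇ i) ∨ ((p ≤ᵇ x) ∧ (x <ᵇ p + j))

  inRegion⇔ : ∀ i j x → T (inRegionᵇ i j x) ⇔ Region i j x
  inRegion⇔ i j x = (<ᵇ⇔ ⊎-⇔ T-∧⇔ ≤ᵇ⇔ (λ _ → <ᵇ⇔)) ⇔-∘ T-∨

  Agrees : (ℕ → ℕ) → ℕ → ℕ → Vec (Fin N) N → Set
  Agrees ν i j m = ∀ x → x < N → Region i j x → entry m x ≡ ν x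

  agreesOnᵇ : (ℕ → ℕ) → ℕ → ℕ → Vec (Fin N) N → Bool
  agreesOnᵇ ν i j m = allᵇ (λ X → not (inRegionᵇ i j (toℕ X)) ∨ (toℕ (lookup m X) ≡ᵇ ν (toℕ X))) (allFin N)

  agreesOn⇔ : ∀ ν i j m → T (agreesOnᵇ ν i j m) ⇔ Agrees ν i j m
  agreesOn⇔ ν i j m = allFin⇔ at
    where
    implication : ∀ {a b} → T (not a ∨ b) ⇔ (T a → T b)
    implication {true} = mk⇔ (λ t _ → t) (λ f → f _)
    implication {false} = mk⇔ (λ _ ()) (λ _ → _)
    at : ∀ X → T (not (inRegionᵇ i j (toℕ X)) ∨ (toℕ (lookup m X) ≡ᵇ ν (toℕ X))) ⇔
               (Region i j (toℕ X) → entry m (toℕ X) ≡ ν (toℕ X))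
    at X = →-cong-⇔ (inRegion⇔ i j (toℕ X)) (≡ᵇ⇔ ⇔-∘ T-cong (cong (_≡ᵇ ν (toℕ X)) (sym (entry-lookup m X))))
             ⇔-∘ implication

  Completion : (ℕ → ℕ) → ℕ → ℕ → Vec (Fin N) N → Set
  Completion ν i j m = Admissible (entry m) × Agrees ν i j m

  completes : (ℕ → ℕ) → ℕ → ℕ → Vec (Fin N) N → Bool
  completes ν i j m = isValid p q m ∧ agreesOnᵇ ν i j m

  completes⇔ : ∀ ν i j m → T (completes ν i j m) ⇔ Completion ν i j m
  completes⇔ ν i j m = T-∧⇔ (admissible⇔ m) (λ _ → agreesOn⇔ ν i j m)

  failing : ∀ {ν i j} (test : Vec (Fin N) N → Bool) m → T (completes ν i j m ∧ not (test m)) →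
    Completion ν i j m × ¬ T (test m)
  failing {ν} {i} {j} test m = to (T-∧⇔ (completes⇔ ν i j m) (λ _ → T-not))

  module _ {i j i′ j′ a b} (M : Move i j i′ j′ a b) where
    open Move M

    agrees-extend : ∀ ν m → Agrees ν i j m → entry m a ≡ b → entry m b ≡ a → Agrees (pairUp ν a b) i′ j′ m
    agrees-extend ν m g ma mb x x<N R′x with grows x R′x
    ... | inj₁ Rx = trans (g x x<N Rx) (sym (unchanged M ν Rx))
    ... | inj₂ (inj₁ refl) = trans ma (sym (pairUp-a ν a b))
    ... | inj₂ (inj₂ refl) = trans mb (sym (pairUp-b ν a b (<⇒≢ a<b)))

    agrees-restrict : ∀ ν m → Agrees (pairUp ν a b) i′ j′ m → Agrees ν i j m
    agrees-restrict ν m g x x<N Rx = trans (g x x<N (keeps x Rx)) (unchanged M ν Rx)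

    refine : ∀ ν (test : Vec (Fin N) N → Bool) →
      (∀ m → Admissible (entry m) → Agrees ν i j m → T (test m) ⇔ (entry m a ≡ b)) →
      ∀ m → (completes ν i j m ∧ test m) ≡ completes (pairUp ν a b) i′ j′ m
    refine ν test detects m =
      T-injective (⇔-sym (completes⇔ (pairUp ν a b) i′ j′ m) ⇔-∘
                   (mk⇔ with-chord without-chord ⇔-∘ T-∧⇔ (completes⇔ ν i j m) λ (A , g) → detects m A g))
      where
      with-chord : Completion ν i j m × entry m a ≡ b → Completion (pairUp ν a b) i′ j′ m
      with-chord ((A , g) , ma) =
        A , agrees-extend ν m g ma (trans (cong (entry m) (sym ma)) (Admissible.involutive A a a<N))
      without-chord : Completion (pairUp ν a b) i′ j′ m → Completion ν i j m × entry m a ≡ b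
      without-chord (A , g′) = (A , agrees-restrict ν m g′) , trans (g′ a a<N added-a) (pairUp-a ν a b)

  joins₁ : ℕ → Vec (Fin N) N → Bool
  joins₁ i m = (suc i <ᵇ p) ∧ (entry m i ≡ᵇ suc i)

  joins₂ : ℕ → Vec (Fin N) N → Bool
  joins₂ j m = (suc j <ᵇ q) ∧ (entry m (p + j) ≡ᵇ suc (p + j))

  joins₁⇔ : ∀ i m → T (joins₁ i m) ⇔ (suc i < p × entry m i ≡ suc i)
  joins₁⇔ i m = T-∧⇔ <ᵇ⇔ (λ _ → ≡ᵇ⇔)

  joins₂⇔ : ∀ j m → T (joins₂ j m) ⇔ (suc j < q × entry m (p + j) ≡ suc (p + j))
  joins₂⇔ j m = T-∧⇔ <ᵇ⇔ (λ _ → ≡ᵇ⇔)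

  module FirstFree {ν i j} (i≤p : i ≤ p) (P : PartialPairing (Region i j) ν)
                   (m : Vec (Fin N) N) (A : Admissible (entry m)) (g : Agrees ν i j m) where
    open Admissible A
    f = entry m

    stays-free : ∀ x → x < N → ¬ Region i j x → ¬ Region i j (f x)
    stays-free x x<N ¬Rx Rfx =
      ¬Rx (subst (Region i j) (trans (sym (g (f x) (bounded x x<N) Rfx)) (involutive x x<N))
                              (PartialPairing.closed P (f x) Rfx))

    -- a chord along a line joins neighbours, since no point lies inside it
    next-on-line : ∀ x → x < N → x < f x → SameLine x (f x) → f x ≡ suc x
    next-on-line x x<N x<fx s with m≤n⇒m<n∨m≡n x<fx
    ... | inj₁ 1+x<fx = ⊥-elim (empty-segments x (suc x) x<N (n<1+n x) 1+x<fx s)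
    ... | inj₂ e = sym e

    partner-after : ∀ x → x < N → ¬ Region i j x → (f x < p → i ≤ f x) × (p ≤ f x → p + j ≤ f x)
    partner-after x x<N ¬Rx = fresh₁ (stays-free x x<N ¬Rx) , fresh₂ (stays-free x x<N ¬Rx)

    i<N : i < p → i < N
    i<N i<p = <-≤-trans i<p (m≤m+n p q)

    first-free₁ : i < p → ¬ T (joins₁ i m) → p + j ≤ f i
    first-free₁ i<p ¬join with f i <? p
    ... | no fi≮p = proj₂ (partner-after i (i<N i<p) ¬Ri) (≮⇒≥ fi≮p)
      where ¬Ri = outside₁ ≤-refl i<p
    ... | yes fi<p = ⊥-elim (¬join (from (joins₁⇔ i m) (subst (_< p) fi≡1+i fi<p , fi≡1+i)))
      where
      i<fi = ≤∧≢⇒< (proj₁ (partner-after i (i<N i<p) (outside₁ ≤-refl i<p)) fi<p)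
                   (λ i≡fi → fixpoint-free i (i<N i<p) (sym i≡fi))
      fi≡1+i = next-on-line i (i<N i<p) i<fi (inj₁ (i<p , fi<p))

    first-free₂ : j < q → ¬ T (joins₂ j m) → f (p + j) < p
    first-free₂ j<q ¬join with f (p + j) <? p
    ... | yes fy<p = fy<p
    ... | no fy≮p = ⊥-elim (¬join (from (joins₂⇔ j m) (1+j<q , fy≡1+y)))
      where
      y<N = +-monoʳ-< p j<q
      ¬Ry = outside₂ i≤p ≤-refl
      y<fy = ≤∧≢⇒< (proj₂ (partner-after (p + j) y<N ¬Ry) (≮⇒≥ fy≮p))
                   (λ y≡fy → fixpoint-free (p + j) y<N (sym y≡fy))
      fy≡1+y = next-on-line (p + j) y<N y<fy (inj₂ (m≤m+n p j , ≮⇒≥ fy≮p))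
      1+j<q : suc j < q
      1+j<q = +-cancelˡ-< p (suc j) q
                (subst (_< N) (trans fy≡1+y (sym (+-suc p j))) (bounded (p + j) y<N))

    i≤first-free₂ : j < q → ¬ T (joins₂ j m) → i ≤ f (p + j)
    i≤first-free₂ j<q ¬join =
      proj₁ (partner-after (p + j) (+-monoʳ-< p j<q) (outside₂ i≤p ≤-refl)) (first-free₂ j<q ¬join)

    free-pair : i < p → j < q → ¬ T (joins₁ i m) → ¬ T (joins₂ j m) → f i ≡ p + j
    free-pair i<p j<q ¬join₁ ¬join₂ with m≤n⇒m<n∨m≡n (i≤first-free₂ j<q ¬join₂)
    ... | inj₂ i≡fy = trans (cong f i≡fy) (involutive (p + j) (+-monoʳ-< p j<q))
    ... | inj₁ i<fy = ⊥-elim (non-crossing i (f y) (i<p , p≤fi , fy<p , p≤ffy , i<fy , ffy<fi))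
      where
      y = p + j
      y<N = +-monoʳ-< p j<q
      fy<p = first-free₂ j<q ¬join₂
      y≤fi = first-free₁ i<p ¬join₁
      p≤fi = ≤-trans (m≤m+n p j) y≤fi
      ffy≡y = involutive y y<N
      p≤ffy = subst (p ≤_) (sym ffy≡y) (m≤m+n p j)
      fi≢y : f i ≢ y
      fi≢y fi≡y = <-irrefl (sym (trans (sym (cong f fi≡y)) (involutive i (i<N i<p)))) i<fy
      ffy<fi = subst (_< f i) (sym ffy≡y) (≤∧≢⇒< y≤fi (λ y≡fi → fi≢y (sym y≡fi)))

    stuck₁ : i < p → j ≡ q → ¬ T (joins₁ i m) → ⊥
    stuck₁ i<p refl ¬join = <⇒≱ (bounded i (i<N i<p)) (first-free₁ i<p ¬join)

    stuck₂ : i ≡ p → j < q → ¬ T (joins₂ j m) → ⊥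
    stuck₂ refl j<q ¬join = <⇒≱ (first-free₂ j<q ¬join) (i≤first-free₂ j<q ¬join)

  total⇒admissible : ∀ {ν} → PartialPairing (Region p q) ν → Admissible ν
  total⇒admissible {ν} P = record
    { bounded = λ x x<N → region-< (closed x (everywhere x<N))
    ; involutive = λ x x<N → involutive x (everywhere x<N)
    ; fixpoint-free = fixpoint-free
    ; empty-segments = empty-segments
    ; non-crossing = λ x y (x<p , px , y<p , py , x<y , νy<νx) →
        <-asym νy<νx (ordered x y (everywhere (<N x<p)) (everywhere (<N y<p)) x<p px y<p py x<y)
    }
    where
    open PartialPairing P
    <N : ∀ {x} → x < p → x < N
    <N x<p = <-≤-trans x<p (m≤m+n p q)
    region-< : ∀ {x} → Region p q x → x < N
    region-< (inj₁ x<p) = <N x<p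
    region-< (inj₂ (_ , x<N)) = x<N
    sameLine-refl : ∀ x → SameLine x x
    sameLine-refl x with x <? p
    ... | yes x<p = inj₁ (x<p , x<p)
    ... | no x≮p = inj₂ (≮⇒≥ x≮p , ≮⇒≥ x≮p)
    fixpoint-free : ∀ x → x < N → ν x ≢ x
    fixpoint-free x x<N νx≡x
      with adjacent x (everywhere x<N) (subst (SameLine x) (sym νx≡x) (sameLine-refl x))
    ... | inj₁ νx≡1+x = 1+n≢n (trans (sym νx≡1+x) νx≡x)
    ... | inj₂ x≡1+νx = 1+n≢n (trans (sym x≡1+νx) (sym νx≡x))
    empty-segments : ∀ x c → x < N → x < c → c < ν x → SameLine x (ν x) → ⊥
    empty-segments x c x<N x<c c<νx s with adjacent x (everywhere x<N) s
    ... | inj₁ νx≡1+x = <⇒≱ x<c (s≤s⁻¹ (subst (c <_) νx≡1+x c<νx))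
    ... | inj₂ x≡1+νx = <-asym (<-trans x<c c<νx) (subst (ν x <_) (sym x≡1+νx) (n<1+n (ν x)))

  admissible-cong : ∀ {f g} → (∀ x → x < N → f x ≡ g x) → Admissible f → Admissible g
  admissible-cong {f} {g} f≗g A = record
    { bounded = λ x x<N → subst (_< N) (f≗g x x<N) (bounded x x<N)
    ; involutive = λ x x<N → trans (sym (g∘g x x<N)) (involutive x x<N)
    ; fixpoint-free = λ x x<N gx≡x → fixpoint-free x x<N (trans (f≗g x x<N) gx≡x)
    ; empty-segments = λ x c x<N x<c c<gx s →
        empty-segments x c x<N x<c (subst (c <_) (sym (f≗g x x<N)) c<gx)
                       (subst (SameLine x) (sym (f≗g x x<N)) s)
    ; non-crossing = λ x y cr →
        non-crossing x y (subst₂ (Crossing x y) (sym (f≗g x (proj₁ (crossing-<N cr))))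
                                                (sym (f≗g y (proj₂ (crossing-<N cr)))) cr)
    }
    where
    open Admissible A
    g∘g : ∀ x → x < N → f (f x) ≡ g (g x)
    g∘g x x<N = trans (cong f (f≗g x x<N)) (f≗g (g x) (subst (_< N) (f≗g x x<N) (bounded x x<N)))

  configurations : List (Vec (Fin N) N)
  configurations = allVecs N N

  count-total : ∀ {ν} → PartialPairing (Region p q) ν → count (completes ν p q) configurations ≡ 1
  count-total {ν} P =
    trans (count-cong _ (agreesᵇ ν) configurations (λ m → T-injective (itself m)))
          (unique-vector N N ν (Admissible.bounded A))
    where
    A = total⇒admissible P
    equal : ∀ m → Completion ν p q m ⇔ (∀ x → x < N → entry m x ≡ ν x)
    equal m = mk⇔ (λ (_ , g) x x<N → g x x<N (everywhere x<N))
                  (λ m≗ν → admissible-cong (λ x x<N → sym (m≗ν x x<N)) A , λ x x<N _ → m≗ν x x<N)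
    itself : ∀ m → T (completes ν p q m) ⇔ T (agreesᵇ ν m)
    itself m = ⇔-sym (agreesᵇ⇔ ν m) ⇔-∘ (equal m ⇔-∘ completes⇔ ν p q m)

  detects₁ : ∀ {i} → suc (suc i) ≤ p → ∀ m → T (joins₁ i m) ⇔ (entry m i ≡ suc i)
  detects₁ {i} 2+i≤p m = mk⇔ (λ t → proj₂ (to (joins₁⇔ i m) t)) (λ e → from (joins₁⇔ i m) (2+i≤p , e))

  detects₂ : ∀ {j} → suc (suc j) ≤ q → ∀ m → T (joins₂ j m) ⇔ (entry m (p + j) ≡ suc (p + j))
  detects₂ {j} 2+j≤q m = mk⇔ (λ t → proj₂ (to (joins₂⇔ j m) t)) (λ e → from (joins₂⇔ j m) (2+j≤q , e))

  detects-across : ∀ {ν i j} → i ≤ p → PartialPairing (Region i j) ν → i < p → j < q → ∀ m →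
    Admissible (entry m) → Agrees ν i j m → T (not (joins₁ i m) ∧ not (joins₂ j m)) ⇔ (entry m i ≡ p + j)
  detects-across {ν} {i} {j} i≤p P i<p j<q m A g =
    mk⇔ (λ (¬j₁ , ¬j₂) → free-pair i<p j<q ¬j₁ ¬j₂) (λ fi≡y → ¬joins₁ fi≡y , ¬joins₂ fi≡y)
    ⇔-∘ T-∧⇔ T-not (λ _ → T-not)
    where
    open FirstFree i≤p P m A g
    open Admissible A
    ¬joins₁ : f i ≡ p + j → ¬ T (joins₁ i m)
    ¬joins₁ fi≡y t = let (1+i<p , fi≡1+i) = to (joins₁⇔ i m) t in
      <⇒≱ 1+i<p (subst (p ≤_) (trans (sym fi≡y) fi≡1+i) (m≤m+n p j))
    ¬joins₂ : f i ≡ p + j → ¬ T (joins₂ j m)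
    ¬joins₂ fi≡y t = let (_ , fy≡1+y) = to (joins₂⇔ j m) t in
      <⇒≱ (<-≤-trans i<p (≤-trans (m≤m+n p j) (n≤1+n _)))
          (≤-reflexive (trans (sym fy≡1+y) (trans (cong f (sym fi≡y)) (involutive i (i<N i<p)))))

-- Counting completions by the first free point

-- Numbers of completions, computed by deciding the partner of the first free
-- point: α r s for r free points on the first line and s on the second, and
-- β r s for r + 1 and s free points when the first free point of the first
-- line is not joined to its neighbour.
α β : ℕ → ℕ → ℕ
α zero zero = 1
α zero (suc zero) = 0
α zero (suc (suc s)) = α zero s
α (suc zero) s = β zero s
α (suc (suc r)) s = α r s + β (suc r) s
β r zero = 0
β r (suc zero) = α r zero
β r (suc (suc s)) = β r s + α r (suc s)

-- bookkeeping for i + r ≡ n, where r counts the free points after i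
≤-of : ∀ i r {n} → i + r ≡ n → i ≤ n
≤-of i r e = subst (i ≤_) e (m≤m+n i r)

<-of : ∀ i r {n} → i + suc r ≡ n → i < n
<-of i r e = ≤-of (suc i) r (trans (sym (+-suc i r)) e)

shift : ∀ i r {n} → i + suc r ≡ n → suc i + r ≡ n
shift i r e = trans (sym (+-suc i r)) e

shift₂ : ∀ i r {n} → i + suc (suc r) ≡ n → suc (suc i) + r ≡ n
shift₂ i r e = shift (suc i) r (shift i (suc r) e)

end : ∀ i {n} → i + 0 ≡ n → i ≡ n
end i e = trans (sym (+-identityʳ i)) e

last : ∀ i {n} → i + 1 ≡ n → suc i ≡ n
last i e = end (suc i) (shift i 0 e)

module Recursion (p q : ℕ) where
  open Positions p q
  open PartialPairings p q

  completes⁺ : (ℕ → ℕ) → ℕ → ℕ → Vec (Fin N) N → Bool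
  completes⁺ ν i j m = completes ν i j m ∧ not (joins₁ i m)

  count-refine : ∀ {i j i′ j′ a b} → Move i j i′ j′ a b → ∀ ν test →
    (∀ m → Admissible (entry m) → Agrees ν i j m → T (test m) ⇔ (entry m a ≡ b)) →
    count (λ m → completes ν i j m ∧ test m) configurations ≡
    count (completes (pairUp ν a b) i′ j′) configurations
  count-refine M ν test detects = count-cong _ _ configurations (refine M ν test detects)

  no-room₁ : ∀ c i m → suc i ≡ p → ¬ T (c ∧ joins₁ i m)
  no-room₁ c i m 1+i≡p t = <-irrefl 1+i≡p (proj₁ (to (joins₁⇔ i m) (proj₂ (T-∧.to {c} t))))

  no-room₂ : ∀ c j m → suc j ≡ q → ¬ T (c ∧ joins₂ j m)
  no-room₂ c j m 1+j≡q t = <-irrefl 1+j≡q (proj₁ (to (joins₂⇔ j m) (proj₂ (T-∧.to {c} t))))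

  count-across : ∀ r s {i j ν} → i + suc r ≡ p → j + suc s ≡ q → PartialPairing (Region i j) ν →
    count (λ m → completes⁺ ν i j m ∧ not (joins₂ j m)) configurations ≡
    count (completes (pairUp ν i (p + j)) (suc i) (suc j)) configurations
  count-across r s {i} {j} {ν} e₁ e₂ P =
    trans (count-cong _ _ configurations
                      (λ m → ∧-assoc (completes ν i j m) (not (joins₁ i m)) (not (joins₂ j m))))
          (count-refine (across i<p) ν _ (detects-across (<⇒≤ i<p) P i<p (<-of j s e₂)))
    where i<p = <-of i r e₁

  extend-across : ∀ r {i j ν} → i + suc r ≡ p → PartialPairing (Region i j) ν →
    PartialPairing (Region (suc i) (suc j)) (pairUp ν i (p + j))
  extend-across r {i} e₁ P = extend (<⇒≤ (<-of i r e₁)) P (across (<-of i r e₁))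

  count-α : ∀ r s {i j ν} → i + r ≡ p → j + s ≡ q → PartialPairing (Region i j) ν →
    count (completes ν i j) configurations ≡ α r s
  count-β : ∀ r s {i j ν} → i + suc r ≡ p → j + s ≡ q → PartialPairing (Region i j) ν →
    count (completes⁺ ν i j) configurations ≡ β r s

  count-α zero zero {i} {j} e₁ e₂ P with end i e₁ | end j e₂
  ... | refl | refl = count-total P
  -- a single free point: it has no partner
  count-α zero (suc zero) {i} {j} {ν} e₁ e₂ P =
    trans (count-split (completes ν i j) (joins₂ j) configurations)
          (cong₂ _+_ (count-never _ configurations no-room) (count-never _ configurations stuck))
    where
    no-room : ∀ m → ¬ T (completes ν i j m ∧ joins₂ j m)
    no-room m = no-room₂ (completes ν i j m) j m (last j e₂)
    stuck : ∀ m → ¬ T (completes ν i j m ∧ not (joins₂ j m))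
    stuck m t = let ((A , g) , ¬j₂) = failing (joins₂ j) m t in
      FirstFree.stuck₂ (≤-of i 0 e₁) P m A g (end i e₁) (<-of j 0 e₂) ¬j₂
  -- free points only on the second line: the first one joins its neighbour
  count-α zero (suc (suc s)) {i} {j} {ν} e₁ e₂ P =
    trans (count-split (completes ν i j) (joins₂ j) configurations)
          (trans (cong₂ _+_ (trans (count-refine M ν (joins₂ j) (λ m _ _ → detects₂ 2+j≤q m))
                                   (count-α zero s e₁ (shift₂ j s e₂) (extend i≤p P M)))
                            (count-never _ configurations stuck))
                 (+-identityʳ _))
    where
    i≤p = ≤-of i 0 e₁
    2+j≤q = ≤-of (suc (suc j)) s (shift₂ j s e₂)
    M = along₂ i≤p 2+j≤q
    stuck : ∀ m → ¬ T (completes ν i j m ∧ not (joins₂ j m))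
    stuck m t = let ((A , g) , ¬j₂) = failing (joins₂ j) m t in
      FirstFree.stuck₂ i≤p P m A g (end i e₁) (<-of j (suc s) e₂) ¬j₂
  -- the last point of the first line has no neighbour to join
  count-α (suc zero) s {i} {j} {ν} e₁ e₂ P =
    trans (count-split (completes ν i j) (joins₁ i) configurations)
          (cong₂ _+_ (count-never _ configurations no-room) (count-β zero s e₁ e₂ P))
    where
    no-room : ∀ m → ¬ T (completes ν i j m ∧ joins₁ i m)
    no-room m = no-room₁ (completes ν i j m) i m (last i e₁)
  -- the first free point of the first line joins its neighbour, or not
  count-α (suc (suc r)) s {i} {j} {ν} e₁ e₂ P =
    trans (count-split (completes ν i j) (joins₁ i) configurations)
          (cong₂ _+_ (trans (count-refine M ν (joins₁ i) (λ m _ _ → detects₁ 2+i≤p m))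
                            (count-α r s (shift₂ i r e₁) e₂ (extend (≤-of i _ e₁) P M)))
                     (count-β (suc r) s e₁ e₂ P))
    where
    2+i≤p = ≤-of (suc (suc i)) r (shift₂ i r e₁)
    M = along₁ 2+i≤p

  -- no free point on the second line is left for the first free point of the first
  count-β r zero {i} {j} {ν} e₁ e₂ P = count-never _ configurations stuck
    where
    stuck : ∀ m → ¬ T (completes⁺ ν i j m)
    stuck m t = let ((A , g) , ¬j₁) = failing (joins₁ i) m t in
      FirstFree.stuck₁ (<⇒≤ (<-of i r e₁)) P m A g (<-of i r e₁) (end j e₂) ¬j₁
  -- the last point of the second line is joined to the first free point of the first
  count-β r (suc zero) {i} {j} {ν} e₁ e₂ P =
    trans (count-split (completes⁺ ν i j) (joins₂ j) configurations)
          (cong₂ _+_ (count-never _ configurations no-room)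
                     (trans (count-across r zero e₁ e₂ P)
                            (count-α r zero (shift i r e₁) (shift j 0 e₂) (extend-across r e₁ P))))
    where
    no-room : ∀ m → ¬ T (completes⁺ ν i j m ∧ joins₂ j m)
    no-room m = no-room₂ (completes⁺ ν i j m) j m (last j e₂)
  -- the first free point of the second line joins its neighbour, or the first
  -- free point of the first line
  count-β r (suc (suc s)) {i} {j} {ν} e₁ e₂ P =
    trans (count-split (completes⁺ ν i j) (joins₂ j) configurations)
          (cong₂ _+_ (trans (count-cong _ _ configurations along)
                            (count-β r s e₁ (shift₂ j s e₂) (extend i≤p P M)))
                     (trans (count-across r (suc s) e₁ e₂ P)
                            (count-α r (suc s) (shift i r e₁) (shift j (suc s) e₂) (extend-across r e₁ P))))
    where
    i≤p = <⇒≤ (<-of i r e₁)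
    2+j≤q = ≤-of (suc (suc j)) s (shift₂ j s e₂)
    M = along₂ i≤p 2+j≤q
    along : ∀ m → (completes⁺ ν i j m ∧ joins₂ j m) ≡
                  completes⁺ (pairUp ν (p + j) (suc (p + j))) i (suc (suc j)) m
    along m = trans (∧-swapʳ (completes ν i j m) (not (joins₁ i m)) (joins₂ j m))
                    (cong (_∧ not (joins₁ i m)) (refine M ν (joins₂ j) (λ m _ _ → detects₂ 2+j≤q m) m))

  empty-region : ∀ {x} → ¬ Region 0 0 x
  empty-region (inj₁ ())
  empty-region (inj₂ (p≤x , x<p+0)) = <⇒≱ (subst (_ <_) (+-identityʳ p) x<p+0) p≤x

  initial : PartialPairing (Region 0 0) (λ x → x)
  initial = record
    { closed = λ _ R → ⊥-elim (empty-region R) ; involutive = λ _ R → ⊥-elim (empty-region R)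
    ; adjacent = λ _ R _ → ⊥-elim (empty-region R) ; ordered = λ _ _ R → ⊥-elim (empty-region R) }

  -- every valid pairing completes the empty partial pairing
  a≡α : a p q ≡ α p q
  a≡α = trans (count-cong (isValid p q) (completes (λ x → x) 0 0) configurations unconstrained)
              (count-α p q refl refl initial)
    where
    unconstrained : ∀ m → isValid p q m ≡ completes (λ x → x) 0 0 m
    unconstrained m = T-injective (mk⇔
      (λ t → T-∧.from (t , from (agreesOn⇔ (λ x → x) 0 0 m) (λ _ _ R → ⊥-elim (empty-region R))))
      (λ t → proj₁ (T-∧.to {isValid p q m} t)))

-- Power series: finite sums, and products with monomials

Σ< : (ℕ → ℤ) → ℕ → ℤ
Σ< f zero = + 0
Σ< f (suc n) = Σ< f n +ℤ f n

sumℤ-snoc : ∀ xs y → sumℤ (xs ++ y ∷ []) ≡ sumℤ xs +ℤ y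
sumℤ-snoc [] y = trans (ℤ.+-identityʳ y) (sym (ℤ.+-identityˡ y))
sumℤ-snoc (x ∷ xs) y = trans (cong (λ z → x +ℤ z) (sumℤ-snoc xs y)) (sym (ℤ.+-assoc x (sumℤ xs) y))

sumℤ-upTo : ∀ f n → sumℤ (map f (upTo n)) ≡ Σ< f n
sumℤ-upTo f zero = refl
sumℤ-upTo f (suc n) = begin
  sumℤ (map f (upTo (suc n)))        ≡⟨ cong (λ l → sumℤ (map f l)) (sym (upTo-∷ʳ n)) ⟩
  sumℤ (map f (upTo n ++ n ∷ []))    ≡⟨ cong sumℤ (map-++ f (upTo n) (n ∷ [])) ⟩
  sumℤ (map f (upTo n) ++ f n ∷ [])  ≡⟨ sumℤ-snoc (map f (upTo n)) (f n) ⟩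
  sumℤ (map f (upTo n)) +ℤ f n        ≡⟨ cong (_+ℤ f n) (sumℤ-upTo f n) ⟩
  Σ< f n +ℤ f n                       ∎
  where open ≡-Reasoning

Σ<-cong : ∀ f g n → (∀ i → i < n → f i ≡ g i) → Σ< f n ≡ Σ< g n
Σ<-cong f g zero e = refl
Σ<-cong f g (suc n) e = cong₂ _+ℤ_ (Σ<-cong f g n (λ i i<n → e i (m<n⇒m<1+n i<n))) (e n (n<1+n n))

Σ<-zero : ∀ f n → (∀ i → i < n → f i ≡ + 0) → Σ< f n ≡ + 0
Σ<-zero f zero e = refl
Σ<-zero f (suc n) e =
  cong₂ _+ℤ_ (Σ<-zero f n (λ i i<n → e i (m<n⇒m<1+n i<n))) (e n (n<1+n n))

Σ<-single : ∀ f n a → a < n → (∀ i → i < n → i ≢ a → f i ≡ + 0) → Σ< f n ≡ f a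
Σ<-single f (suc n) a a<1+n others with m<1+n⇒m<n∨m≡n a<1+n
... | inj₂ refl =
  trans (cong (_+ℤ f a) (Σ<-zero f n (λ i i<n → others i (m<n⇒m<1+n i<n) (λ { refl → <-irrefl refl i<n }))))
        (ℤ.+-identityˡ (f a))
... | inj₁ a<n = trans (cong₂ _+ℤ_ (Σ<-single f n a a<n (λ i i<n → others i (m<n⇒m<1+n i<n)))
                                  (others n (n<1+n n) (λ { refl → <-irrefl refl a<n })))
                       (ℤ.+-identityʳ (f a))

Σ<-sub : ∀ f g n → Σ< (λ i → f i -ℤ g i) n ≡ Σ< f n -ℤ Σ< g n
Σ<-sub f g zero = refl
Σ<-sub f g (suc n) rewrite Σ<-sub f g n =
  solve 4 (λ A B x y → (A :- B) :+ (x :- y) := (A :+ x) :- (B :+ y)) refl (Σ< f n) (Σ< g n) (f n) (g n)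

Σ<-if : ∀ (c : Bool) (g : ℕ → ℤ) n → Σ< (λ j → if c then g j else + 0) n ≡ (if c then Σ< g n else + 0)
Σ<-if true g n = refl
Σ<-if false g n = Σ<-zero _ n (λ _ _ → refl)

Σ<-pick : ∀ n c (h : ℕ → ℤ) →
  Σ< (λ j → if (n ∸ j ≡ᵇ c) then h j else + 0) (suc n) ≡ (if c ≤ᵇ n then h (n ∸ c) else + 0)
Σ<-pick n c h with c ≤? n
... | yes c≤n rewrite decided ≤ᵇ⇔ c≤n =
  trans (Σ<-single _ (suc n) (n ∸ c) (s≤s (m∸n≤m n c)) others) picked
  where
  others : ∀ j → j < suc n → j ≢ n ∸ c → (if (n ∸ j ≡ᵇ c) then h j else + 0) ≡ + 0
  others j (s≤s j≤n) j≢n∸c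
    rewrite refuted (≡ᵇ⇔ {n ∸ j} {c}) (λ e → j≢n∸c (trans (sym (m∸[m∸n]≡n j≤n)) (cong (n ∸_) e))) = refl
  picked : (if (n ∸ (n ∸ c) ≡ᵇ c) then h (n ∸ c) else + 0) ≡ h (n ∸ c)
  picked rewrite m∸[m∸n]≡n c≤n | decided (≡ᵇ⇔ {c}) refl = refl
... | no c≰n rewrite refuted ≤ᵇ⇔ c≰n = Σ<-zero _ (suc n) none
  where
  none : ∀ j → j < suc n → (if (n ∸ j ≡ᵇ c) then h j else + 0) ≡ + 0
  none j _ rewrite refuted (≡ᵇ⇔ {n ∸ j} {c}) (λ e → c≰n (subst (_≤ n) e (m∸n≤m n j))) = refl

⊛-Σ< : ∀ F G k n → (F ⊛ G) k n ≡ Σ< (λ i → Σ< (λ j → F i j *ℤ G (k ∸ i) (n ∸ j)) (suc n)) (suc k)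
⊛-Σ< F G k n = trans (cong sumℤ (map-cong (λ i → sumℤ-upTo _ (suc n)) (upTo (suc k)))) (sumℤ-upTo _ (suc k))

_≗₂_ : FPS2 → FPS2 → Set
F ≗₂ G = ∀ k n → F k n ≡ G k n

⊛-cong : ∀ {F F′ G G′} → F ≗₂ F′ → G ≗₂ G′ → (F ⊛ G) ≗₂ (F′ ⊛ G′)
⊛-cong eF eG k n =
  cong sumℤ (map-cong (λ i → cong sumℤ (map-cong (λ j → cong₂ _*ℤ_ (eF i j) (eG _ _)) (upTo (suc n))))
                      (upTo (suc k)))

⊛-⊖ʳ : ∀ F G H → (F ⊛ (G ⊖ H)) ≗₂ ((F ⊛ G) ⊖ (F ⊛ H))
⊛-⊖ʳ F G H k n rewrite ⊛-Σ< F (G ⊖ H) k n | ⊛-Σ< F G k n | ⊛-Σ< F H k n =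
  trans (Σ<-cong _ _ (suc k) (λ i _ → trans (Σ<-cong _ _ (suc n) (λ j _ → distrib (F i j) _ _)) (Σ<-sub _ _ (suc n))))
        (Σ<-sub _ _ (suc k))
  where
  distrib : ∀ a b c → a *ℤ (b -ℤ c) ≡ a *ℤ b -ℤ a *ℤ c
  distrib = solve 3 (λ a b c → a :* (b :- c) := a :* b :- a :* c) refl

δ : ℕ → ℕ → FPS2
δ a b k n = if (k ≡ᵇ a) ∧ (n ≡ᵇ b) then + 1 else + 0

shifted : FPS2 → ℕ → ℕ → FPS2
shifted F c d k n = if c ≤ᵇ k then (if d ≤ᵇ n then F (k ∸ c) (n ∸ d) else + 0) else + 0

⊛-δ : ∀ F c d → (F ⊛ δ c d) ≗₂ shifted F c d
⊛-δ F c d k n = trans (⊛-Σ< F (δ c d) k n)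
  (trans (Σ<-cong _ _ (suc k) (λ i _ → row i)) (Σ<-pick k c (λ i → if d ≤ᵇ n then F i (n ∸ d) else + 0)))
  where
  times-if : ∀ (b b′ : Bool) x → x *ℤ (if b ∧ b′ then + 1 else + 0) ≡ (if b then (if b′ then x else + 0) else + 0)
  times-if true true x = ℤ.*-identityʳ x
  times-if true false x = ℤ.*-zeroʳ x
  times-if false b′ x = ℤ.*-zeroʳ x
  row : ∀ i → Σ< (λ j → F i j *ℤ δ c d (k ∸ i) (n ∸ j)) (suc n) ≡
              (if (k ∸ i ≡ᵇ c) then (if d ≤ᵇ n then F i (n ∸ d) else + 0) else + 0)
  row i = trans (Σ<-cong _ _ (suc n) (λ j _ → times-if (k ∸ i ≡ᵇ c) (n ∸ j ≡ᵇ d) (F i j)))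
          (trans (Σ<-if (k ∸ i ≡ᵇ c) (λ j → if (n ∸ j ≡ᵇ d) then F i j else + 0) (suc n))
                 (cong (λ z → if (k ∸ i ≡ᵇ c) then z else + 0) (Σ<-pick n d (F i))))

shifted-⊖ : ∀ F G c d → shifted (F ⊖ G) c d ≗₂ (shifted F c d ⊖ shifted G c d)
shifted-⊖ F G c d k n with c ≤ᵇ k | d ≤ᵇ n
... | true | true = refl
... | true | false = refl
... | false | _ = refl

∸-≡ᵇ : ∀ {k c} a → c ≤ k → (k ∸ c ≡ᵇ a) ≡ (k ≡ᵇ a + c)
∸-≡ᵇ {k} {c} a c≤k = T-injective (mk⇔
  (λ t → ≡⇒≡ᵇ _ _ (trans (sym (m∸n+n≡m c≤k)) (cong (_+ c) (≡ᵇ⇒≡ _ _ t))))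
  (λ t → ≡⇒≡ᵇ _ _ (trans (cong (_∸ c) (≡ᵇ⇒≡ _ _ t)) (m+n∸n≡m a c))))

≰⇒≢+ : ∀ {k c a} → ¬ c ≤ k → k ≢ a + c
≰⇒≢+ c≰k refl = c≰k (m≤n+m _ _)

δ-shift : ∀ a b c d → shifted (δ a b) c d ≗₂ δ (a + c) (b + d)
δ-shift a b c d k n with c ≤? k | d ≤? n
... | yes c≤k | yes d≤n rewrite decided ≤ᵇ⇔ c≤k | decided ≤ᵇ⇔ d≤n | ∸-≡ᵇ a c≤k | ∸-≡ᵇ b d≤n = refl
... | yes c≤k | no d≰n
  rewrite decided ≤ᵇ⇔ c≤k | refuted ≤ᵇ⇔ d≰n | refuted ≡ᵇ⇔ (≰⇒≢+ {a = b} d≰n) | ∧-zeroʳ (k ≡ᵇ a + c) = refl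
... | no c≰k | _ rewrite refuted ≤ᵇ⇔ c≰k | refuted ≡ᵇ⇔ (≰⇒≢+ {a = a} c≰k) = refl

⊖-cong : ∀ {F F′ G G′} → F ≗₂ F′ → G ≗₂ G′ → (F ⊖ G) ≗₂ (F′ ⊖ G′)
⊖-cong eF eG k n = cong₂ _-ℤ_ (eF k n) (eG k n)

monomial-product : ∀ {F G} a b c d → F ≗₂ δ a b → G ≗₂ δ c d → (F ⊛ G) ≗₂ δ (a + c) (b + d)
monomial-product a b c d eF eG k n =
  trans (⊛-cong eF eG k n) (trans (⊛-δ (δ a b) c d k n) (δ-shift a b c d k n))

oneS-δ : oneS ≗₂ δ 0 0
oneS-δ zero zero = refl
oneS-δ zero (suc n) = refl
oneS-δ (suc k) n = refl

X-δ : X ≗₂ δ 1 0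
X-δ zero n = refl
X-δ (suc zero) zero = refl
X-δ (suc zero) (suc n) = refl
X-δ (suc (suc k)) n = refl

Y-δ : Y ≗₂ δ 0 1
Y-δ zero zero = refl
Y-δ zero (suc zero) = refl
Y-δ zero (suc (suc n)) = refl
Y-δ (suc k) n = refl

denominator : FPS2
denominator = ((δ 0 0 ⊖ δ 2 0) ⊖ (δ 0 2 ⊖ δ 2 2)) ⊖ δ 1 1

denom-expanded : denom ≗₂ denominator
denom-expanded k n = begin
  denom k n
    ≡⟨ ⊖-cong (⊛-cong (⊖-cong oneS-δ (monomial-product 1 0 1 0 X-δ X-δ))
                      (⊖-cong oneS-δ (monomial-product 0 1 0 1 Y-δ Y-δ)))
              (monomial-product 1 0 0 1 X-δ Y-δ) k n ⟩
  ((F ⊛ (δ 0 0 ⊖ δ 0 2)) ⊖ δ 1 1) k n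
    ≡⟨ cong (_-ℤ δ 1 1 k n) (⊛-⊖ʳ F (δ 0 0) (δ 0 2) k n) ⟩
  (F ⊛ δ 0 0) k n -ℤ (F ⊛ δ 0 2) k n -ℤ δ 1 1 k n
    ≡⟨ cong (_-ℤ δ 1 1 k n) (cong₂ _-ℤ_ (⊛-δ F 0 0 k n) (⊛-δ F 0 2 k n)) ⟩
  shifted F 0 0 k n -ℤ shifted F 0 2 k n -ℤ δ 1 1 k n
    ≡⟨ cong (_-ℤ δ 1 1 k n) (cong₂ _-ℤ_ (shifted-monomials 0 0) (shifted-monomials 0 2)) ⟩
  denominator k n ∎
  where
  open ≡-Reasoning
  F = δ 0 0 ⊖ δ 2 0
  shifted-monomials : ∀ c d → shifted F c d k n ≡ δ c d k n -ℤ δ (2 + c) d k n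
  shifted-monomials c d = trans (shifted-⊖ (δ 0 0) (δ 2 0) c d k n)
                                (cong₂ _-ℤ_ (δ-shift 0 0 c d k n) (δ-shift 2 0 c d k n))

times-denominator : FPS2 → FPS2
times-denominator G k n =
  ((shifted G 0 0 k n -ℤ shifted G 2 0 k n) -ℤ (shifted G 0 2 k n -ℤ shifted G 2 2 k n)) -ℤ shifted G 1 1 k n

⊛-denominator : ∀ G → (G ⊛ denominator) ≗₂ times-denominator G
⊛-denominator G k n =
  trans (⊛-⊖ʳ G ((δ 0 0 ⊖ δ 2 0) ⊖ (δ 0 2 ⊖ δ 2 2)) (δ 1 1) k n) (cong₂ _-ℤ_
    (trans (⊛-⊖ʳ G (δ 0 0 ⊖ δ 2 0) (δ 0 2 ⊖ δ 2 2) k n) (cong₂ _-ℤ_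
      (trans (⊛-⊖ʳ G (δ 0 0) (δ 2 0) k n) (cong₂ _-ℤ_ (⊛-δ G 0 0 k n) (⊛-δ G 2 0 k n)))
      (trans (⊛-⊖ʳ G (δ 0 2) (δ 2 2) k n) (cong₂ _-ℤ_ (⊛-δ G 0 2 k n) (⊛-δ G 2 2 k n)))))
    (⊛-δ G 1 1 k n))

Gα : FPS2
Gα k n = + α k n

-- The recursion for α and β, read off at x^k y^n, says that Gα times the
-- denominator is 1.
α-recurrence : times-denominator Gα ≗₂ oneS
α-recurrence zero zero = refl
α-recurrence zero (suc zero) = refl
α-recurrence zero (suc (suc n)) =
  solve 1 (λ a → ((a :- con (+ 0)) :- (a :- con (+ 0))) :- con (+ 0) := con (+ 0)) refl (+ α 0 n)
α-recurrence (suc zero) zero = refl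
α-recurrence (suc zero) (suc zero) = refl
α-recurrence (suc zero) (suc (suc n)) rewrite ℤ.pos-+ (β 0 n) (α 0 (suc n)) =
  solve 2 (λ b c → (((b :+ c) :- con (+ 0)) :- (b :- con (+ 0))) :- c := con (+ 0)) refl (+ β 0 n) (+ α 0 (suc n))
α-recurrence (suc (suc k)) zero rewrite ℤ.pos-+ (α k 0) (β (suc k) 0) =
  solve 1 (λ a → (((a :+ con (+ 0)) :- a) :- (con (+ 0) :- con (+ 0))) :- con (+ 0) := con (+ 0)) refl (+ α k 0)
α-recurrence (suc (suc k)) (suc zero) rewrite ℤ.pos-+ (α k 1) (α (suc k) 0) =
  solve 2 (λ a c → (((a :+ c) :- a) :- (con (+ 0) :- con (+ 0))) :- c := con (+ 0)) refl (+ α k 1) (+ α (suc k) 0)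
α-recurrence (suc (suc k)) (suc (suc n))
  rewrite ℤ.pos-+ (α k (suc (suc n))) (β (suc k) n + α (suc k) (suc n))
        | ℤ.pos-+ (β (suc k) n) (α (suc k) (suc n))
        | ℤ.pos-+ (α k n) (β (suc k) n) =
  solve 4 (λ a b c d → (((a :+ (b :+ c)) :- a) :- ((d :+ b) :- d)) :- c := con (+ 0)) refl
    (+ α k (suc (suc n))) (+ β (suc k) n) (+ α (suc k) (suc n)) (+ α k n)

mainTheorem17 : ∀ (k n : ℕ) → (genA ⊛ denom) k n ≡ oneS k n
mainTheorem17 k n = begin
  (genA ⊛ denom) k n          ≡⟨ ⊛-cong (λ k n → cong +_ (Recursion.a≡α k n)) denom-expanded k n ⟩
  (Gα ⊛ denominator) k n      ≡⟨ ⊛-denominator Gα k n ⟩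
  times-denominator Gα k n    ≡⟨ α-recurrence k n ⟩
  oneS k n                    ∎
  where open ≡-Reasoning
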